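{- Let $F_n$ be the friendship graph with $n\ge 2$. Then $\gamma_{tc}(M(F_n))=2n+1$.
   Context: All graphs are finite, simple and undirected. The friendship graph $F_n$ is the graph of order $2n+1$ obtained by joining $n$ copies of the cycle $C_3$ at a common vertex; i.e., vertices $v_0,\dots,v_{2n}$ and edges $v_0v_i$ ($1\le i\le 2n$) and $v_{2k-1}v_{2k}$ ($1\le k\le n$). For a graph $H$, a set $D\subseteq V(H)$ is a total dominating set if every vertex of $H$ has a neighbor in $D$. A set $D\subseteq V(H)$ is a total outer-connected dominating set of $H$ if $D$ is a total dominating set and the induced subgraph $H[V(H)\setminus D]$ is connected; $\gamma_{tc}(H)$ denotes the minimum cardinality of a total outer-connected dominating set of $H$. The middle graph $M(G)$ of a graph $G$ has vertex set $V(G)\cup E(G)$, where two elements $x,y$ are adjacent iff either $x,y\in E(G)$ are edges of $G$ sharing an endpoint, or one of them is a vertex of $G$ and the other is an edge of $G$ incident to it. -}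

module Defs where

open import Data.Bool using (Bool; true; false; _∧_; _∨_; not; if_then_else_)
open import Data.Nat using (ℕ; zero; suc; _+_; _*_; _≡ᵇ_; _<ᵇ_; _≤_)
open import Data.Nat.DivMod using (_/_)
open import Data.Fin using (Fin; toℕ; splitAt; _≟_)
open import Data.Fin.Subset using (Subset; _∈_; _∉_; ∣_∣)
open import Data.List using (List; []; _∷_; length; concatMap; lookup; allFin)
open import Data.Product using (_×_; _,_; proj₁; proj₂; ∃)
open import Data.Sum using (inj₁; inj₂)
open import Relation.Binary.PropositionalEquality using (_≡_)
open import Relation.Nullary.Decidable using (⌊_⌋)

record Graph : Set where
  field
    order : ℕ
    adj   : Fin order → Fin order → Bool
open Graph public

-- Adjacency of the friendship graph on vertices v_0 .. v_{2n} (indices in ℕ):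
-- v_0 adjacent to all others; v_{2k-1} ~ v_{2k}.
friendAdjℕ : ℕ → ℕ → Bool
friendAdjℕ zero    zero    = false
friendAdjℕ zero    (suc _) = true
friendAdjℕ (suc _) zero    = true
friendAdjℕ (suc a) (suc b) = not (a ≡ᵇ b) ∧ ((a / 2) ≡ᵇ (b / 2))

Friendship : ℕ → Graph
Friendship n = record
  { order = suc (2 * n)
  ; adj   = λ i j → friendAdjℕ (toℕ i) (toℕ j) }

edges : (G : Graph) → List (Fin (order G) × Fin (order G))
edges G = concatMap (λ i → concatMap (λ j →
            if (toℕ i <ᵇ toℕ j) ∧ adj G i j then (i , j) ∷ [] else []) (allFin (order G)))
          (allFin (order G))

size : Graph → ℕ
size G = length (edges G)

-- The middle graph M(G): vertex set V(G) ⊎ E(G), encoded as Fin (order G + size G),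
-- the first (order G) elements being the vertices, the rest the edges.
middleAdj : (G : Graph) → Fin (order G + size G) → Fin (order G + size G) → Bool
middleAdj G x y with splitAt (order G) x | splitAt (order G) y
... | inj₁ u | inj₁ v = false
... | inj₁ u | inj₂ e = incident u (lookup (edges G) e)
  where incident : Fin (order G) → Fin (order G) × Fin (order G) → Bool
        incident w (a , b) = ⌊ w ≟ a ⌋ ∨ ⌊ w ≟ b ⌋
... | inj₂ e | inj₁ u = incident u (lookup (edges G) e)
  where incident : Fin (order G) → Fin (order G) × Fin (order G) → Bool
        incident w (a , b) = ⌊ w ≟ a ⌋ ∨ ⌊ w ≟ b ⌋
... | inj₂ e | inj₂ f = not ⌊ e ≟ f ⌋ ∧ share (lookup (edges G) e) (lookup (edges G) f)
  where share : Fin (order G) × Fin (order G) → Fin (order G) × Fin (order G) → Bool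
        share (a , b) (c , d) = ⌊ a ≟ c ⌋ ∨ ⌊ a ≟ d ⌋ ∨ ⌊ b ≟ c ⌋ ∨ ⌊ b ≟ d ⌋

Middle : Graph → Graph
Middle G = record { order = order G + size G ; adj = middleAdj G }

IsTotalDominating : (G : Graph) → Subset (order G) → Set
IsTotalDominating G D = ∀ v → ∃ λ u → u ∈ D × adj G v u ≡ true

data WalkOutside (G : Graph) (D : Subset (order G)) : Fin (order G) → Fin (order G) → Set where
  here : ∀ {u} → u ∉ D → WalkOutside G D u u
  step : ∀ {u w v} → u ∉ D → adj G u w ≡ true → WalkOutside G D w v → WalkOutside G D u v

ComplementConnected : (G : Graph) → Subset (order G) → Set
ComplementConnected G D = ∀ u v → u ∉ D → v ∉ D → WalkOutside G D u v

IsTotalOuterConnectedDominating : (G : Graph) → Subset (order G) → Set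
IsTotalOuterConnectedDominating G D = IsTotalDominating G D × ComplementConnected G D

γtc≡ : Graph → ℕ → Set
γtc≡ G k = (∃ λ D → IsTotalOuterConnectedDominating G D × ∣ D ∣ ≡ k)
         × (∀ D → IsTotalOuterConnectedDominating G D → k ≤ ∣ D ∣)

-- The middle graph M(F_n) consists of the hub v₀ and n blocks; block k holds two leaves
-- v_{2k+1}, v_{2k+2}, their spokes v₀v_{2k+1}, v₀v_{2k+2} and the rim v_{2k+1}v_{2k+2}.
-- All spokes are mutually adjacent (they share v₀); otherwise a block only touches itself,
-- and the hub only touches spokes. Total domination of a block's two leaves and its rim
-- forces at least two of its five vertices into D. The hub needs a spoke in D; if the hub
-- itself is outside D, the block of that spoke needs a third vertex of D, for otherwise a leaf
-- or the whole block outside D is cut off from the hub. Hence |D| ≥ 2n + 1. Conversely the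
-- first spoke of one block together with the first leaf and the rim of every block is a total
-- outer-connected dominating set: everything outside it reaches the hub along spokes.
module Submission where

open import Defs
open import Data.Bool using (Bool; true; false; _∧_; _∨_; not; if_then_else_)
open import Data.Bool.Properties using (∧-zeroʳ; ∨-zeroʳ)
open import Data.Nat using (ℕ; zero; suc; _+_; _*_; _<_; _≤_; _≡ᵇ_; _<ᵇ_; z≤n; s≤s; z<s; s<s⁻¹)
open import Data.Nat.Properties
  using (*-suc; *-comm; +-comm; +-identityʳ; +-suc; <-irrefl; <-trans; <⇒≢; n<1+n; ≤-refl; ≤-trans;
         ≤-reflexive; ≤-antisym; m≤n⇒m≤1+n; +-monoʳ-≤; +-mono-≤; module ≤-Reasoning)
import Data.Nat.Properties as ℕ
open import Data.Nat.DivMod using (_/_; m*n/n≡m; +-distrib-/; m*n%n≡0)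
open import Data.Fin using (Fin; toℕ; splitAt; join; cast; combine; remQuot; _≟_)
import Data.Fin as Fin
open import Data.Fin.Patterns using (0F; 1F)
open import Data.Fin.Properties
  using (toℕ-injective; toℕ-cast; toℕ-combine; cast-involutive; remQuot-combine; combine-remQuot;
         splitAt-join; join-splitAt; suc-injective)
open import Data.Fin.Subset using (Subset; _∈_; _∉_; ∣_∣; _∪_; ⁅_⁆; ⋃; inside; outside)
open import Data.Fin.Subset.Properties
  using (_∈?_; x∈p∧x≢y⇒x∈p-y; x∈p⇒∣p-x∣<∣p∣; ∣p∣≤∣x∷p∣; ∣⁅x⁆∣≡1; ∣⊥∣≡0; x∈⁅x⁆; x∈⁅y⁆⇒x≡y;
         x∈p∪q⁺; x∈p∪q⁻; ∉⊥)
open import Data.List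
  using (List; []; _∷_; [_]; _++_; concat; concatMap; applyUpTo; tabulate; map; length; lookup; allFin;
         filter; cartesianProductWith)
open import Data.List.Properties
  using (++-assoc; map-concatMap; concatMap-cong; map-tabulate; tabulate-cong; map-injective; length-tabulate;
         lookup-tabulate; length-map; length-++; filter-++; filter-accept)
open import Data.List.Membership.Propositional using () renaming (_∈_ to _∈ₗ_)
open import Data.List.Membership.Propositional.Properties
  using (∈-allFin; ∈-cartesianProductWith⁻; ∈-map⁺; ∈-map⁻; ∈-++⁺ˡ; ∈-++⁺ʳ; ∈-++⁻; ∈-tabulate⁺; ∈-tabulate⁻)
open import Data.List.Relation.Binary.Sublist.Propositional using (_⊆_; []; _∷_; _∷ʳ_)
open import Data.List.Relation.Unary.All using (All; []; _∷_)
import Data.List.Relation.Unary.All as All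
open import Data.List.Relation.Unary.All.Properties using (all-filter) renaming (map⁺ to All-map⁺)
open import Data.List.Relation.Unary.Any using (here; there)
open import Data.List.Relation.Unary.Unique.Propositional using (Unique; []; _∷_)
open import Data.List.Relation.Unary.Unique.Propositional.Properties using (filter⁺; cartesianProductWith⁺; allFin⁺)
import Data.List.Relation.Unary.Unique.Propositional.Properties as Unique
open import Data.Product using (_×_; _,_; ∃; ∃₂; proj₁; uncurry)
import Data.Product as Product
open import Data.Sum using (_⊎_; inj₁; inj₂; [_,_]′; map₁; map₂)
open import Data.Sum.Properties using (≡-dec)
open import Data.Vec using ([]; _∷_)
open import Function using (_∘_; id; case_of_)
open import Relation.Binary.Definitions using (DecidableEquality)
open import Relation.Nullary using (¬_; Dec; yes; no; contradiction)
open import Relation.Nullary.Decidable using (⌊_⌋; does; dec-true; dec-false; decidable-stable)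
open import Relation.Unary using (Decidable)
open import Relation.Binary.PropositionalEquality hiding ([_])

private variable
  A : Set
  m n : ℕ

-- Lists and subsets

concatUpTo : (ℕ → List A) → ℕ → List A
concatUpTo f m = concat (applyUpTo f m)

concatUpTo-cong : ∀ n {f g : ℕ → List A} → (∀ {k} → k < n → f k ≡ g k) → concatUpTo f n ≡ concatUpTo g n
concatUpTo-cong zero    eq = refl
concatUpTo-cong (suc n) eq = cong₂ _++_ (eq z<s) (concatUpTo-cong n (λ k<n → eq (s≤s k<n)))

concatUpTo-[] : ∀ n → concatUpTo {A} (λ _ → []) n ≡ []
concatUpTo-[] zero    = refl
concatUpTo-[] (suc n) = concatUpTo-[] n

concatUpTo-singleton : (f : ℕ → A) → ∀ n → concatUpTo (λ k → [ f k ]) n ≡ applyUpTo f n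
concatUpTo-singleton f zero    = refl
concatUpTo-singleton f (suc n) = cong (f 0 ∷_) (concatUpTo-singleton (f ∘ suc) n)

concatUpTo-pairs : (f : ℕ → List A) → ∀ n →
  concatUpTo f (2 * n) ≡ concatUpTo (λ k → f (2 * k) ++ f (suc (2 * k))) n
concatUpTo-pairs f zero    = refl
concatUpTo-pairs f (suc n) = begin
  concatUpTo f (2 * suc n)                            ≡⟨ cong (concatUpTo f) (*-suc 2 n) ⟩
  f 0 ++ (f 1 ++ concatUpTo (f ∘ suc ∘ suc) (2 * n))  ≡⟨ ++-assoc (f 0) (f 1) _ ⟨
  (f 0 ++ f 1) ++ concatUpTo (f ∘ suc ∘ suc) (2 * n)  ≡⟨ cong ((f 0 ++ f 1) ++_) (concatUpTo-pairs (f ∘ suc ∘ suc) n) ⟩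
  (f 0 ++ f 1) ++ concatUpTo (λ k → f (2 + 2 * k) ++ f (3 + 2 * k)) n
    ≡⟨ cong ((f 0 ++ f 1) ++_) (concatUpTo-cong n (λ {k} _ → cong (λ i → f i ++ f (suc i)) (*-suc 2 k))) ⟨
  concatUpTo (λ k → f (2 * k) ++ f (suc (2 * k))) (suc n) ∎
  where open ≡-Reasoning

concatUpTo-δ : (x : A) → ∀ {k} n → k < n → concatUpTo (λ i → if k ≡ᵇ i then [ x ] else []) n ≡ [ x ]
concatUpTo-δ x {zero}  (suc n) _   = cong (x ∷_) (concatUpTo-[] n)
concatUpTo-δ x {suc k} (suc n) k<n = concatUpTo-δ x n (s<s⁻¹ k<n)

tabulate-toℕ : ∀ n (f : ℕ → A) → tabulate {n = n} (f ∘ toℕ) ≡ applyUpTo f n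
tabulate-toℕ zero    f = refl
tabulate-toℕ (suc n) f = cong (f 0 ∷_) (tabulate-toℕ n (f ∘ suc))

tabulate-splitAt : ∀ m {n} (f : Fin m ⊎ Fin n → A) →
  tabulate (f ∘ splitAt m) ≡ tabulate (f ∘ inj₁) ++ tabulate (f ∘ inj₂)
tabulate-splitAt zero    f = refl
tabulate-splitAt (suc m) f = cong (f (inj₁ Fin.zero) ∷_) (tabulate-splitAt m (f ∘ map₁ Fin.suc))

concatMap-allFin : ∀ n (f : ℕ → List A) → concatMap (f ∘ toℕ) (allFin n) ≡ concatUpTo f n
concatMap-allFin n f = cong concat (trans (map-tabulate {n = n} id (f ∘ toℕ)) (tabulate-toℕ n f))

lookup-tabulate-≡ : ∀ {xs : List A} {f : Fin m → A} (eq : xs ≡ tabulate f) (i : Fin (length xs)) →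
  lookup xs i ≡ f (cast (trans (cong length eq) (length-tabulate f)) i)
lookup-tabulate-≡ {f = f} refl i =
  trans (cong (lookup (tabulate f)) (sym (cast-involutive (sym (length-tabulate f)) (length-tabulate f) i)))
        (lookup-tabulate f (cast (length-tabulate f) i))

∣p∪q∣≤∣p∣+∣q∣ : (p q : Subset m) → ∣ p ∪ q ∣ ≤ ∣ p ∣ + ∣ q ∣
∣p∪q∣≤∣p∣+∣q∣ []            []           = z≤n
∣p∪q∣≤∣p∣+∣q∣ (outside ∷ p) (outside ∷ q) = ∣p∪q∣≤∣p∣+∣q∣ p q
∣p∪q∣≤∣p∣+∣q∣ (outside ∷ p) (inside ∷ q)  = ≤-trans (s≤s (∣p∪q∣≤∣p∣+∣q∣ p q)) (≤-reflexive (sym (+-suc ∣ p ∣ ∣ q ∣)))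
∣p∪q∣≤∣p∣+∣q∣ (inside ∷ p)  (c ∷ q)       = s≤s (≤-trans (∣p∪q∣≤∣p∣+∣q∣ p q) (+-monoʳ-≤ ∣ p ∣ (∣p∣≤∣x∷p∣ c q)))

fromList : List (Fin m) → Subset m
fromList xs = ⋃ (map ⁅_⁆ xs)

∣fromList∣≤length : (xs : List (Fin m)) → ∣ fromList xs ∣ ≤ length xs
∣fromList∣≤length {m} []   = ≤-reflexive (∣⊥∣≡0 m)
∣fromList∣≤length (x ∷ xs) = ≤-trans (∣p∪q∣≤∣p∣+∣q∣ ⁅ x ⁆ (fromList xs))
  (≤-trans (≤-reflexive (cong (_+ ∣ fromList xs ∣) (∣⁅x⁆∣≡1 x))) (s≤s (∣fromList∣≤length xs)))

∈-fromList⁺ : ∀ {x} {xs : List (Fin m)} → x ∈ₗ xs → x ∈ fromList xs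
∈-fromList⁺ (here refl)  = x∈p∪q⁺ (inj₁ (x∈⁅x⁆ _))
∈-fromList⁺ (there x∈xs) = x∈p∪q⁺ (inj₂ (∈-fromList⁺ x∈xs))

∈-fromList⁻ : ∀ {x} (xs : List (Fin m)) → x ∈ fromList xs → x ∈ₗ xs
∈-fromList⁻ []       x∈ = contradiction x∈ ∉⊥
∈-fromList⁻ (y ∷ xs) x∈ with x∈p∪q⁻ ⁅ y ⁆ (fromList xs) x∈
... | inj₁ x∈⁅y⁆ = here (x∈⁅y⁆⇒x≡y y x∈⁅y⁆)
... | inj₂ x∈xs  = there (∈-fromList⁻ xs x∈xs)

Unique⇒length≤∣∣ : ∀ {p : Subset m} {xs} → Unique xs → All (_∈ p) xs → length xs ≤ ∣ p ∣
Unique⇒length≤∣∣ []                 []            = z≤n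
Unique⇒length≤∣∣ (x≢xs ∷ xs-unique) (x∈p ∷ xs⊆p) =
  ≤-trans (s≤s (Unique⇒length≤∣∣ xs-unique (All.zipWith (λ (y∈p , x≢y) → x∈p∧x≢y⇒x∈p-y y∈p (x≢y ∘ sym)) (xs⊆p , x≢xs))))
          (x∈p⇒∣p-x∣<∣p∣ x∈p)

length-≤-filter : ∀ {P : A → Set} (P? : Decidable P) {ys xs : List A} →
  ys ⊆ xs → All P ys → length ys ≤ length (filter P? xs)
length-≤-filter P? []              []  = z≤n
length-≤-filter P? (y ∷ʳ ys⊆xs)   Pys with does (P? y)
... | true  = m≤n⇒m≤1+n (length-≤-filter P? ys⊆xs Pys)
... | false = length-≤-filter P? ys⊆xs Pys
length-≤-filter P? {y ∷ _} (refl ∷ ys⊆xs) (Py ∷ Pys) with P? y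
... | yes _   = s≤s (length-≤-filter P? ys⊆xs Pys)
... | no ¬Py = contradiction Py ¬Py

module _ {B C : Set} {P : C → Set} (P? : Decidable P) (f : A → B → C) (ys : List B) where

  private
    count : A → ℕ
    count x = length (filter P? (map (f x) ys))

    total : List A → ℕ
    total xs = length (filter P? (cartesianProductWith f xs ys))

    total-∷ : ∀ x xs → total (x ∷ xs) ≡ count x + total xs
    total-∷ x xs = trans (cong length (filter-++ P? (map (f x) ys) _)) (length-++ (filter P? (map (f x) ys)))

  filter-cartesianProductWith-≥ : ∀ c → (∀ x → c ≤ count x) → ∀ xs → length xs * c ≤ total xs
  filter-cartesianProductWith-≥ c c≤ []       = z≤n
  filter-cartesianProductWith-≥ c c≤ (x ∷ xs) =
    subst (_ ≤_) (sym (total-∷ x xs)) (+-mono-≤ (c≤ x) (filter-cartesianProductWith-≥ c c≤ xs))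

  filter-cartesianProductWith-> : ∀ c → (∀ x → c ≤ count x) → ∀ {x₀ xs} → x₀ ∈ₗ xs → suc c ≤ count x₀ →
    suc (length xs * c) ≤ total xs
  filter-cartesianProductWith-> c c≤ {xs = x ∷ xs} (here refl) c<x₀ =
    subst (_ ≤_) (sym (total-∷ x xs)) (+-mono-≤ c<x₀ (filter-cartesianProductWith-≥ c c≤ xs))
  filter-cartesianProductWith-> c c≤ {xs = x ∷ xs} (there x₀∈xs) c<x₀ =
    subst₂ _≤_ (+-suc c (length xs * c)) (sym (total-∷ x xs))
      (+-mono-≤ (c≤ x) (filter-cartesianProductWith-> c c≤ x₀∈xs c<x₀))

-- Walks outside a set

module _ {G : Graph} {D : Subset (order G)} where

  walk-++ : ∀ {u v w} → WalkOutside G D u v → WalkOutside G D v w → WalkOutside G D u w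
  walk-++ (here _)          q = q
  walk-++ (step u∉D u∼w p) q = step u∉D u∼w (walk-++ p q)

  walk-start∉ : ∀ {u v} → WalkOutside G D u v → u ∉ D
  walk-start∉ (here u∉D)     = u∉D
  walk-start∉ (step u∉D _ _) = u∉D

  OutsideClosed : (Fin (order G) → Set) → Set
  OutsideClosed S = ∀ {x y} → S x → x ∉ D → adj G x y ≡ true → y ∉ D → S y

  walk-preserves : ∀ {S} → OutsideClosed S → ∀ {u v} → WalkOutside G D u v → S u → S v
  walk-preserves closed (here _)          Su = Su
  walk-preserves closed (step u∉D u∼w p) Su = walk-preserves closed p (closed Su u∉D u∼w (walk-start∉ p))

  closed-contains-outside : ComplementConnected G D → ∀ {S} → OutsideClosed S →
    ∀ {u v} → S u → u ∉ D → v ∉ D → S v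
  closed-contains-outside connected closed Su u∉D v∉D = walk-preserves closed (connected _ _ u∉D v∉D) Su

  connected-through : ∀ c → (∀ u → u ∉ D → WalkOutside G D u c) → (∀ v → v ∉ D → WalkOutside G D c v) →
    ComplementConnected G D
  connected-through c to from u v u∉D v∉D = walk-++ (to u u∉D) (from v v∉D)

-- Middle graphs of edge-enumerated graphs

∨-true⁻ : ∀ {a b} → a ∨ b ≡ true → a ≡ true ⊎ b ≡ true
∨-true⁻ {true}  _ = inj₁ refl
∨-true⁻ {false} h = inj₂ h

isYes⇒ : ∀ {P : Set} (P? : Dec P) → ⌊ P? ⌋ ≡ true → P
isYes⇒ (yes p) _ = p

isYes-≟-injective : {E E′ : Set} (_≟E_ : DecidableEquality E) (_≟E′_ : DecidableEquality E′) {φ : E → E′} →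
  (∀ {e f} → φ e ≡ φ f → e ≡ f) → ∀ e f → ⌊ e ≟E f ⌋ ≡ ⌊ φ e ≟E′ φ f ⌋
isYes-≟-injective _≟E_ _≟E′_ {φ} φ-injective e f with e ≟E f | φ e ≟E′ φ f
... | yes _    | yes _     = refl
... | no _     | no _      = refl
... | yes refl | no φe≢φe  = contradiction refl φe≢φe
... | no e≢f   | yes φe≡φf = contradiction (φ-injective φe≡φf) e≢f

module _ {V : Set} (_≟V_ : DecidableEquality V) where

  incident : V → V × V → Bool
  incident w (a , b) = ⌊ w ≟V a ⌋ ∨ ⌊ w ≟V b ⌋

  shareEnd : V × V → V × V → Bool
  shareEnd (a , b) (c , d) = ⌊ a ≟V c ⌋ ∨ ⌊ a ≟V d ⌋ ∨ ⌊ b ≟V c ⌋ ∨ ⌊ b ≟V d ⌋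

  incident-fst : ∀ w b → incident w (w , b) ≡ true
  incident-fst w b with w ≟V w
  ... | yes _   = refl
  ... | no w≢w = contradiction refl w≢w

  incident-snd : ∀ a w → incident w (a , w) ≡ true
  incident-snd a w with w ≟V w
  ... | yes _   = ∨-zeroʳ _
  ... | no w≢w = contradiction refl w≢w

  middleAdjacency : {E : Set} → DecidableEquality E → (E → V × V) → V ⊎ E → V ⊎ E → Bool
  middleAdjacency _≟E_ ends (inj₁ u) (inj₁ v) = false
  middleAdjacency _≟E_ ends (inj₁ u) (inj₂ e) = incident u (ends e)
  middleAdjacency _≟E_ ends (inj₂ e) (inj₁ u) = incident u (ends e)
  middleAdjacency _≟E_ ends (inj₂ e) (inj₂ f) = not ⌊ e ≟E f ⌋ ∧ shareEnd (ends e) (ends f)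

  middleAdjacency-relabel : {E E′ : Set} (_≟E_ : DecidableEquality E) (_≟E′_ : DecidableEquality E′)
    {ends : E → V × V} {ends′ : E′ → V × V} {φ : E → E′} →
    (∀ {e f} → φ e ≡ φ f → e ≡ f) → (∀ e → ends e ≡ ends′ (φ e)) →
    ∀ x y → middleAdjacency _≟E_ ends x y ≡ middleAdjacency _≟E′_ ends′ (map₂ φ x) (map₂ φ y)
  middleAdjacency-relabel _ _ φ-injective eq (inj₁ u) (inj₁ v) = refl
  middleAdjacency-relabel _ _ φ-injective eq (inj₁ u) (inj₂ e) = cong (incident u) (eq e)
  middleAdjacency-relabel _ _ φ-injective eq (inj₂ e) (inj₁ u) = cong (incident u) (eq e)
  middleAdjacency-relabel _≟E_ _≟E′_ φ-injective eq (inj₂ e) (inj₂ f) =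
    cong₂ (λ b s → not b ∧ s) (isYes-≟-injective _≟E_ _≟E′_ φ-injective e f) (cong₂ shareEnd (eq e) (eq f))

middleAdj-splitAt : (G : Graph) → ∀ x y →
  middleAdj G x y ≡ middleAdjacency _≟_ _≟_ (lookup (edges G)) (splitAt (order G) x) (splitAt (order G) y)
middleAdj-splitAt G x y with splitAt (order G) x | splitAt (order G) y
... | inj₁ u | inj₁ v = refl
... | inj₁ u | inj₂ e with lookup (edges G) e
...   | a , b = refl
middleAdj-splitAt G x y | inj₂ e | inj₁ u with lookup (edges G) e
...   | a , b = refl
middleAdj-splitAt G x y | inj₂ e | inj₂ f with lookup (edges G) e | lookup (edges G) f
...   | a , b | c , d = refl

-- The edge list of the friendship graph

toℕ² : Fin m × Fin m → ℕ × ℕ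
toℕ² = Product.map toℕ toℕ

toℕ²-injective : {p q : Fin m × Fin m} → toℕ² p ≡ toℕ² q → p ≡ q
toℕ²-injective eq = cong₂ _,_ (toℕ-injective (cong Product.proj₁ eq)) (toℕ-injective (cong Product.proj₂ eq))

cellℕ : (ℕ → ℕ → Bool) → ℕ → ℕ → List (ℕ × ℕ)
cellℕ adjℕ a b = if (a <ᵇ b) ∧ adjℕ a b then [ (a , b) ] else []

edgesℕ : (ℕ → ℕ → Bool) → ℕ → List (ℕ × ℕ)
edgesℕ adjℕ N = concatUpTo (λ a → concatUpTo (cellℕ adjℕ a) N) N

map-toℕ²-edges : (N : ℕ) (adjℕ : ℕ → ℕ → Bool) →
  map toℕ² (edges (record { order = N ; adj = λ i j → adjℕ (toℕ i) (toℕ j) })) ≡ edgesℕ adjℕ N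
map-toℕ²-edges N adjℕ = begin
  map toℕ² (concatMap row (allFin N))                              ≡⟨ map-concatMap toℕ² row (allFin N) ⟩
  concatMap (map toℕ² ∘ row) (allFin N)                            ≡⟨ concatMap-cong row-toℕ² (allFin N) ⟩
  concatMap (λ i → concatUpTo (cellℕ adjℕ (toℕ i)) N) (allFin N)
    ≡⟨ concatMap-allFin N (λ a → concatUpTo (cellℕ adjℕ a) N) ⟩
  edgesℕ adjℕ N                                                    ∎
  where
  open ≡-Reasoning
  cell : Fin N → Fin N → List (Fin N × Fin N)
  cell i j = if (toℕ i <ᵇ toℕ j) ∧ adjℕ (toℕ i) (toℕ j) then [ (i , j) ] else []
  row : Fin N → List (Fin N × Fin N)
  row i = concatMap (cell i) (allFin N)
  cell-toℕ² : ∀ i j → map toℕ² (cell i j) ≡ cellℕ adjℕ (toℕ i) (toℕ j)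
  cell-toℕ² i j with (toℕ i <ᵇ toℕ j) ∧ adjℕ (toℕ i) (toℕ j)
  ... | true  = refl
  ... | false = refl
  row-toℕ² : ∀ i → map toℕ² (row i) ≡ concatUpTo (cellℕ adjℕ (toℕ i)) N
  row-toℕ² i = begin
    map toℕ² (row i)                                 ≡⟨ map-concatMap toℕ² (cell i) (allFin N) ⟩
    concatMap (map toℕ² ∘ cell i) (allFin N)         ≡⟨ concatMap-cong (cell-toℕ² i) (allFin N) ⟩
    concatMap (cellℕ adjℕ (toℕ i) ∘ toℕ) (allFin N)  ≡⟨ concatMap-allFin N (cellℕ adjℕ (toℕ i)) ⟩
    concatUpTo (cellℕ adjℕ (toℕ i)) N                ∎

half-even : ∀ k → 2 * k / 2 ≡ k
half-even k = trans (cong (_/ 2) (*-comm 2 k)) (m*n/n≡m k 2)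

half-odd : ∀ k → suc (2 * k) / 2 ≡ k
half-odd k = begin
  suc (2 * k) / 2  ≡⟨ cong (λ i → suc i / 2) (*-comm 2 k) ⟩
  (1 + k * 2) / 2  ≡⟨ +-distrib-/ 1 (k * 2) (subst (λ r → 1 + r < 2) (sym (m*n%n≡0 k 2)) ≤-refl) ⟩
  0 + k * 2 / 2    ≡⟨ m*n/n≡m k 2 ⟩
  k                ∎
  where open ≡-Reasoning

spokeℕ : ℕ → ℕ × ℕ
spokeℕ t = 0 , suc t

rimℕ : ℕ → ℕ × ℕ
rimℕ k = suc (2 * k) , suc (suc (2 * k))

rimCell : ℕ → ℕ → List (ℕ × ℕ)
rimCell a b = cellℕ friendAdjℕ (suc a) (suc b)

rimCell-apart : ∀ {a b} → a / 2 ≢ b / 2 → rimCell a b ≡ []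
rimCell-apart {a} {b} ne rewrite dec-false (a / 2 ℕ.≟ b / 2) ne | ∧-zeroʳ (not (a ≡ᵇ b)) | ∧-zeroʳ (a <ᵇ b) = refl

module _ {k k′ : ℕ} (k≢k′ : k ≢ k′) where
  rimCell-blocks-apart : ∀ a b → a / 2 ≡ k → b / 2 ≡ k′ → rimCell a b ≡ []
  rimCell-blocks-apart a b ha hb = rimCell-apart (λ e → k≢k′ (trans (sym ha) (trans e hb)))

-- Off the hub, vertices a < b are adjacent exactly when a = 2k and b = 2k + 1.
even-cells : ∀ k k′ → rimCell (2 * k) (2 * k′) ++ rimCell (2 * k) (suc (2 * k′))
                      ≡ (if k ≡ᵇ k′ then [ rimℕ k ] else [])
even-cells k k′ with k ℕ.≟ k′
... | no k≢k′ rewrite dec-false (k ℕ.≟ k′) k≢k′ =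
  cong₂ _++_ (rimCell-blocks-apart k≢k′ (2 * k) (2 * k′) (half-even k) (half-even k′))
             (rimCell-blocks-apart k≢k′ (2 * k) (suc (2 * k′)) (half-even k) (half-odd k′))
... | yes refl
  rewrite dec-false (2 * k ℕ.<? 2 * k) (<-irrefl refl) | dec-true (2 * k ℕ.<? suc (2 * k)) (n<1+n _)
        | dec-false (2 * k ℕ.≟ suc (2 * k)) (<⇒≢ (n<1+n _)) | half-even k | half-odd k
        | dec-true (k ℕ.≟ k) refl = refl

odd-cells : ∀ k k′ → rimCell (suc (2 * k)) (2 * k′) ++ rimCell (suc (2 * k)) (suc (2 * k′)) ≡ []
odd-cells k k′ with k ℕ.≟ k′
... | no k≢k′ = cong₂ _++_ (rimCell-blocks-apart k≢k′ (suc (2 * k)) (2 * k′) (half-odd k) (half-even k′))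
                             (rimCell-blocks-apart k≢k′ (suc (2 * k)) (suc (2 * k′)) (half-odd k) (half-odd k′))
... | yes refl
  rewrite dec-false (suc (2 * k) ℕ.<? 2 * k) (λ lt → <-irrefl refl (<-trans lt (n<1+n (2 * k))))
        | dec-true (suc (2 * k) ℕ.≟ suc (2 * k)) refl | ∧-zeroʳ (suc (2 * k) <ᵇ suc (2 * k)) = refl

rimsℕ : ∀ n → concatUpTo (λ a → concatUpTo (rimCell a) (2 * n)) (2 * n) ≡ applyUpTo rimℕ n
rimsℕ n = begin
  concatUpTo row (2 * n)                                 ≡⟨ concatUpTo-pairs row n ⟩
  concatUpTo (λ k → row (2 * k) ++ row (suc (2 * k))) n
    ≡⟨ concatUpTo-cong n (λ {k} k<n → cong₂ _++_ (row-even k<n) (row-odd k)) ⟩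
  concatUpTo (λ k → [ rimℕ k ]) n                        ≡⟨ concatUpTo-singleton rimℕ n ⟩
  applyUpTo rimℕ n                                       ∎
  where
  open ≡-Reasoning
  row : ℕ → List (ℕ × ℕ)
  row a = concatUpTo (rimCell a) (2 * n)
  row-even : ∀ {k} → k < n → row (2 * k) ≡ [ rimℕ k ]
  row-even {k} k<n = begin
    row (2 * k)                                                ≡⟨ concatUpTo-pairs (rimCell (2 * k)) n ⟩
    concatUpTo (λ k′ → rimCell (2 * k) (2 * k′) ++ rimCell (2 * k) (suc (2 * k′))) n
      ≡⟨ concatUpTo-cong n (λ {k′} _ → even-cells k k′) ⟩
    concatUpTo (λ k′ → if k ≡ᵇ k′ then [ rimℕ k ] else []) n  ≡⟨ concatUpTo-δ (rimℕ k) n k<n ⟩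
    [ rimℕ k ]                                                 ∎
  row-odd : ∀ k → row (suc (2 * k)) ≡ []
  row-odd k = begin
    row (suc (2 * k))                                          ≡⟨ concatUpTo-pairs (rimCell (suc (2 * k))) n ⟩
    concatUpTo (λ k′ → rimCell (suc (2 * k)) (2 * k′) ++ rimCell (suc (2 * k)) (suc (2 * k′))) n
      ≡⟨ concatUpTo-cong n (λ {k′} _ → odd-cells k k′) ⟩
    concatUpTo (λ _ → []) n                                    ≡⟨ concatUpTo-[] n ⟩
    []                                                         ∎

edgesℕ-Friendship : ∀ n → edgesℕ friendAdjℕ (suc (2 * n)) ≡ applyUpTo spokeℕ (2 * n) ++ applyUpTo rimℕ n
edgesℕ-Friendship n = cong₂ _++_ (concatUpTo-singleton spokeℕ (2 * n)) (rimsℕ n)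

leafIndex : Fin n → Fin 2 → Fin (2 * n)
leafIndex {n} k s = cast (*-comm n 2) (combine k s)

toℕ-leafIndex : (k : Fin n) (s : Fin 2) → toℕ (leafIndex k s) ≡ 2 * toℕ k + toℕ s
toℕ-leafIndex {n} k s = trans (toℕ-cast (*-comm n 2) (combine k s)) (toℕ-combine k s)

blockOf : Fin (2 * n) → Fin n × Fin 2
blockOf {n} j = remQuot 2 (cast (*-comm 2 n) j)

blockOf-leafIndex : (k : Fin n) (s : Fin 2) → blockOf (leafIndex k s) ≡ (k , s)
blockOf-leafIndex {n} k s =
  trans (cong (remQuot 2) (cast-involutive (*-comm 2 n) (*-comm n 2) (combine k s))) (remQuot-combine k s)

leafIndex-blockOf : (j : Fin (2 * n)) → uncurry (leafIndex {n}) (blockOf j) ≡ j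
leafIndex-blockOf {n} j = trans (cong (cast (*-comm n 2)) (combine-remQuot {n} 2 (cast (*-comm 2 n) j)))
                                (cast-involutive (*-comm n 2) (*-comm 2 n) j)

FriendshipVertex : ℕ → Set
FriendshipVertex n = Fin (suc (2 * n))

friendshipEnds : Fin (2 * n) ⊎ Fin n → FriendshipVertex n × FriendshipVertex n
friendshipEnds (inj₁ j) = Fin.zero , Fin.suc j
friendshipEnds (inj₂ k) = Fin.suc (leafIndex k 0F) , Fin.suc (leafIndex k 1F)

-- The two lists are compared through toℕ², where the double loop over vertices becomes a loop over ℕ
-- whose rows regroup into the blocks {2k, 2k + 1}.
edges-Friendship : ∀ n → edges (Friendship n) ≡ tabulate (friendshipEnds ∘ splitAt (2 * n))
edges-Friendship n = map-injective toℕ²-injective (begin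
  map toℕ² (edges (Friendship n))                                 ≡⟨ map-toℕ²-edges (suc (2 * n)) friendAdjℕ ⟩
  edgesℕ friendAdjℕ (suc (2 * n))                                 ≡⟨ edgesℕ-Friendship n ⟩
  applyUpTo spokeℕ (2 * n) ++ applyUpTo rimℕ n                    ≡⟨ cong₂ _++_ (tabulate-toℕ (2 * n) spokeℕ) rims ⟨
  tabulate (toℕ² ∘ ends ∘ inj₁) ++ tabulate (toℕ² ∘ ends ∘ inj₂)  ≡⟨ tabulate-splitAt (2 * n) (toℕ² ∘ ends) ⟨
  tabulate (toℕ² ∘ ends ∘ splitAt (2 * n))                        ≡⟨ map-tabulate (ends ∘ splitAt (2 * n)) toℕ² ⟨
  map toℕ² (tabulate (ends ∘ splitAt (2 * n)))                    ∎)
  where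
  open ≡-Reasoning
  ends : Fin (2 * n) ⊎ Fin n → FriendshipVertex n × FriendshipVertex n
  ends = friendshipEnds
  rim-toℕ² : (k : Fin n) → toℕ² (ends (inj₂ k)) ≡ rimℕ (toℕ k)
  rim-toℕ² k = cong₂ (λ a b → suc a , suc b) (trans (toℕ-leafIndex k 0F) (+-identityʳ _))
                                              (trans (toℕ-leafIndex k 1F) (+-comm _ 1))
  rims : tabulate (toℕ² ∘ ends ∘ inj₂) ≡ applyUpTo rimℕ n
  rims = trans (tabulate-cong rim-toℕ²) (tabulate-toℕ n rimℕ)

-- The middle graph of the friendship graph

module FriendshipSlots (n : ℕ) where

  size-Friendship : size (Friendship n) ≡ 2 * n + n
  size-Friendship = trans (cong length (edges-Friendship n)) (length-tabulate _)

  EdgeSlot : Set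
  EdgeSlot = Fin (2 * n) ⊎ Fin n

  Slot : Set
  Slot = FriendshipVertex n ⊎ EdgeSlot

  edgeSlot : Fin (size (Friendship n)) → EdgeSlot
  edgeSlot = splitAt (2 * n) ∘ cast size-Friendship

  unEdgeSlot : EdgeSlot → Fin (size (Friendship n))
  unEdgeSlot = cast (sym size-Friendship) ∘ join (2 * n) n

  unEdgeSlot-edgeSlot : ∀ e → unEdgeSlot (edgeSlot e) ≡ e
  unEdgeSlot-edgeSlot e = trans (cong (cast (sym size-Friendship)) (join-splitAt (2 * n) n (cast size-Friendship e)))
                                (cast-involutive (sym size-Friendship) size-Friendship e)

  edgeSlot-unEdgeSlot : ∀ z → edgeSlot (unEdgeSlot z) ≡ z
  edgeSlot-unEdgeSlot z = trans (cong (splitAt (2 * n)) (cast-involutive size-Friendship (sym size-Friendship) _))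
                                (splitAt-join (2 * n) n z)

  edgeSlot-injective : ∀ {e f} → edgeSlot e ≡ edgeSlot f → e ≡ f
  edgeSlot-injective {e} {f} eq =
    trans (sym (unEdgeSlot-edgeSlot e)) (trans (cong unEdgeSlot eq) (unEdgeSlot-edgeSlot f))

  slot : Fin (order (Middle (Friendship n))) → Slot
  slot = map₂ edgeSlot ∘ splitAt (suc (2 * n))

  unslot : Slot → Fin (order (Middle (Friendship n)))
  unslot = join (suc (2 * n)) (size (Friendship n)) ∘ map₂ unEdgeSlot

  slot-unslot : ∀ z → slot (unslot z) ≡ z
  slot-unslot (inj₁ v) = cong (map₂ edgeSlot) (splitAt-join (suc (2 * n)) _ (inj₁ v))
  slot-unslot (inj₂ z) = trans (cong (map₂ edgeSlot) (splitAt-join (suc (2 * n)) _ (inj₂ (unEdgeSlot z))))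
                               (cong inj₂ (edgeSlot-unEdgeSlot z))

  unslot-slot : ∀ x → unslot (slot x) ≡ x
  unslot-slot x = trans (cong (join (suc (2 * n)) _) (unEdgeSlot∘edgeSlot (splitAt (suc (2 * n)) x)))
                        (join-splitAt (suc (2 * n)) _ x)
    where
    unEdgeSlot∘edgeSlot : ∀ z → map₂ unEdgeSlot (map₂ edgeSlot z) ≡ z
    unEdgeSlot∘edgeSlot (inj₁ v) = refl
    unEdgeSlot∘edgeSlot (inj₂ e) = cong inj₂ (unEdgeSlot-edgeSlot e)

  adj-slot : ∀ x y → adj (Middle (Friendship n)) x y
                     ≡ middleAdjacency _≟_ (≡-dec _≟_ _≟_) friendshipEnds (slot x) (slot y)
  adj-slot x y = trans (middleAdj-splitAt (Friendship n) x y)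
    (middleAdjacency-relabel _≟_ _≟_ (≡-dec _≟_ _≟_) edgeSlot-injective (lookup-tabulate-≡ (edges-Friendship n))
      (splitAt (suc (2 * n)) x) (splitAt (suc (2 * n)) y))

data Part : Set where
  leaf spoke : Fin 2 → Part
  rim        : Part

-- block k (leaf s) is v_{2k+s+1}, block k (spoke s) the edge v₀v_{2k+s+1},
-- block k rim the edge v_{2k+1}v_{2k+2}.
data Role (n : ℕ) : Set where
  hub   : Role n
  block : Fin n → Part → Role n

module RoleEncoding (n : ℕ) where
  open FriendshipSlots n

  leafVertex : Fin n → Fin 2 → FriendshipVertex n
  leafVertex k s = Fin.suc (leafIndex k s)

  leafVertex-≟ : ∀ k s k′ s′ → ⌊ leafVertex k s ≟ leafVertex k′ s′ ⌋ ≡ true → (k , s) ≡ (k′ , s′)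
  leafVertex-≟ k s k′ s′ h = begin
    (k , s)                           ≡⟨ blockOf-leafIndex k s ⟨
    blockOf (leafIndex k s)           ≡⟨ cong blockOf (suc-injective (isYes⇒ (leafVertex k s ≟ leafVertex k′ s′) h)) ⟩
    blockOf (leafIndex k′ s′)         ≡⟨ blockOf-leafIndex k′ s′ ⟩
    (k′ , s′)                         ∎
    where open ≡-Reasoning

  sameBlock : ∀ k s k′ s′ → ⌊ leafVertex k s ≟ leafVertex k′ s′ ⌋ ≡ true → k ≡ k′
  sameBlock k s k′ s′ h = cong proj₁ (leafVertex-≟ k s k′ s′ h)

  toSlot : Role n → Slot
  toSlot hub                 = inj₁ Fin.zero
  toSlot (block k (leaf s))  = inj₁ (leafVertex k s)
  toSlot (block k (spoke s)) = inj₂ (inj₁ (leafIndex k s))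
  toSlot (block k rim)       = inj₂ (inj₂ k)

  fromSlot : Slot → Role n
  fromSlot (inj₁ Fin.zero)    = hub
  fromSlot (inj₁ (Fin.suc j)) = uncurry (λ k s → block k (leaf s)) (blockOf j)
  fromSlot (inj₂ (inj₁ j))    = uncurry (λ k s → block k (spoke s)) (blockOf j)
  fromSlot (inj₂ (inj₂ k))    = block k rim

  fromSlot-toSlot : ∀ r → fromSlot (toSlot r) ≡ r
  fromSlot-toSlot hub                 = refl
  fromSlot-toSlot (block k (leaf s))  = cong (uncurry (λ k s → block k (leaf s))) (blockOf-leafIndex k s)
  fromSlot-toSlot (block k (spoke s)) = cong (uncurry (λ k s → block k (spoke s))) (blockOf-leafIndex k s)
  fromSlot-toSlot (block k rim)       = refl

  toSlot-fromSlot : ∀ z → toSlot (fromSlot z) ≡ z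
  toSlot-fromSlot (inj₁ Fin.zero)    = refl
  toSlot-fromSlot (inj₁ (Fin.suc j)) = cong (inj₁ ∘ Fin.suc) (leafIndex-blockOf {n} j)
  toSlot-fromSlot (inj₂ (inj₁ j))    = cong (inj₂ ∘ inj₁) (leafIndex-blockOf {n} j)
  toSlot-fromSlot (inj₂ (inj₂ k))    = refl

  adjRole : Role n → Role n → Bool
  adjRole r t = middleAdjacency _≟_ (≡-dec _≟_ _≟_) friendshipEnds (toSlot r) (toSlot t)

  -- Kept opaque so that the type checker never unfolds the edge list of F_n hidden in enc.
  opaque
    enc : Role n → Fin (order (Middle (Friendship n)))
    enc = unslot ∘ toSlot

    dec : Fin (order (Middle (Friendship n))) → Role n
    dec = fromSlot ∘ slot

    enc-dec : ∀ x → enc (dec x) ≡ x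
    enc-dec x = trans (cong unslot (toSlot-fromSlot (slot x))) (unslot-slot x)

    dec-enc : ∀ r → dec (enc r) ≡ r
    dec-enc r = trans (cong fromSlot (slot-unslot (toSlot r))) (fromSlot-toSlot r)

    adj-enc : ∀ r t → adj (Middle (Friendship n)) (enc r) (enc t) ≡ adjRole r t
    adj-enc r t = trans (adj-slot (enc r) (enc t))
      (cong₂ (middleAdjacency _≟_ (≡-dec _≟_ _≟_) friendshipEnds) (slot-unslot (toSlot r)) (slot-unslot (toSlot t)))

  enc-injective : ∀ {r t} → enc r ≡ enc t → r ≡ t
  enc-injective {r} {t} eq = trans (sym (dec-enc r)) (trans (cong dec eq) (dec-enc t))

  adj-enc-dec : ∀ r y → adj (Middle (Friendship n)) (enc r) y ≡ adjRole r (dec y)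
  adj-enc-dec r y = trans (cong (adj (Middle (Friendship n)) (enc r)) (sym (enc-dec y))) (adj-enc r (dec y))

  adj-dec : ∀ x y → adj (Middle (Friendship n)) x y ≡ adjRole (dec x) (dec y)
  adj-dec x y = trans (cong (λ a → adj (Middle (Friendship n)) a y) (sym (enc-dec x))) (adj-enc-dec (dec x) y)

  hub∼spoke : ∀ k s → adjRole hub (block k (spoke s)) ≡ true
  hub∼spoke k s = refl

  spoke∼hub : ∀ k s → adjRole (block k (spoke s)) hub ≡ true
  spoke∼hub k s = refl

  leaf∼spoke : ∀ k s → adjRole (block k (leaf s)) (block k (spoke s)) ≡ true
  leaf∼spoke k s = incident-snd _≟_ Fin.zero (leafVertex k s)

  spoke∼leaf : ∀ k s → adjRole (block k (spoke s)) (block k (leaf s)) ≡ true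
  spoke∼leaf k s = incident-snd _≟_ Fin.zero (leafVertex k s)

  leaf-incident-rim : ∀ k s → incident _≟_ (leafVertex k s) (leafVertex k 0F , leafVertex k 1F) ≡ true
  leaf-incident-rim k 0F = incident-fst _≟_ (leafVertex k 0F) (leafVertex k 1F)
  leaf-incident-rim k 1F = incident-snd _≟_ (leafVertex k 0F) (leafVertex k 1F)

  leaf∼rim : ∀ k s → adjRole (block k (leaf s)) (block k rim) ≡ true
  leaf∼rim = leaf-incident-rim

  spoke∼rim : ∀ k s → adjRole (block k (spoke s)) (block k rim) ≡ true
  spoke∼rim = leaf-incident-rim

  rim∼leaf : ∀ k s → adjRole (block k rim) (block k (leaf s)) ≡ true
  rim∼leaf = leaf-incident-rim

  hub-neighbour : ∀ t → adjRole hub t ≡ true → ∃₂ λ k s → t ≡ block k (spoke s)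
  hub-neighbour (block k (spoke s)) _ = k , s , refl
  hub-neighbour hub                 ()
  hub-neighbour (block k (leaf s))  ()
  hub-neighbour (block k rim)       ()

  leaf-neighbour : ∀ k s t → adjRole (block k (leaf s)) t ≡ true → t ≡ block k (spoke s) ⊎ t ≡ block k rim
  leaf-neighbour k s hub                    ()
  leaf-neighbour k s (block k′ (leaf s′))  ()
  leaf-neighbour k s (block k′ (spoke s′)) h with leafVertex-≟ k s k′ s′ h
  ... | refl = inj₁ refl
  leaf-neighbour k s (block k′ rim) h with ∨-true⁻ h
  ... | inj₁ h₀ with leafVertex-≟ k s k′ 0F h₀
  ...   | refl = inj₂ refl
  leaf-neighbour k s (block k′ rim) h | inj₂ h₁ with leafVertex-≟ k s k′ 1F h₁
  ...   | refl = inj₂ refl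

  rim-neighbour : ∀ k t → adjRole (block k rim) t ≡ true → ∃ λ p → t ≡ block k p × p ≢ rim
  rim-neighbour k hub ()
  rim-neighbour k (block k′ (leaf s′)) h = leaf s′ , cong (λ i → block i (leaf s′)) (sym k≡k′) , λ ()
    where
    k≡k′ : k ≡ k′
    k≡k′ = [ sym ∘ sameBlock k′ s′ k 0F , sym ∘ sameBlock k′ s′ k 1F ]′ (∨-true⁻ h)
  rim-neighbour k (block k′ (spoke s′)) h = spoke s′ , cong (λ i → block i (spoke s′)) (sym k≡k′) , λ ()
    where
    k≡k′ : k ≡ k′
    k≡k′ = [ sameBlock k 0F k′ s′ , sameBlock k 1F k′ s′ ]′ (∨-true⁻ h)
  rim-neighbour k (block k′ rim) h with k ≟ k′
  ... | yes refl = case h of λ ()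
  ... | no k≢k′  = contradiction k≡k′ k≢k′
    where
    k≡k′ : k ≡ k′
    k≡k′ with ∨-true⁻ h
    ... | inj₁ h₀ = sameBlock k 0F k′ 0F h₀
    ... | inj₂ h′ with ∨-true⁻ h′
    ...   | inj₁ h₀ = sameBlock k 0F k′ 1F h₀
    ...   | inj₂ h″ = [ sameBlock k 1F k′ 0F , sameBlock k 1F k′ 1F ]′ (∨-true⁻ h″)

-- The lower bound

parts : List Part
parts = leaf 0F ∷ leaf 1F ∷ spoke 0F ∷ spoke 1F ∷ rim ∷ []

parts-unique : Unique parts
parts-unique = ((λ ()) ∷ (λ ()) ∷ (λ ()) ∷ (λ ()) ∷ []) ∷ ((λ ()) ∷ (λ ()) ∷ (λ ()) ∷ []) ∷
               ((λ ()) ∷ (λ ()) ∷ []) ∷ ((λ ()) ∷ []) ∷ [] ∷ []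

blocks : (n : ℕ) → List (Role n)
blocks n = cartesianProductWith block (allFin n) parts

blocks-unique : ∀ n → Unique (blocks n)
blocks-unique n = cartesianProductWith⁺ block block-injective (allFin⁺ n) parts-unique
  where
  block-injective : ∀ {k k′ p p′} → block k p ≡ block k′ p′ → k ≡ k′ × p ≡ p′
  block-injective refl = refl , refl

hub∉blocks : ∀ n → All (hub ≢_) (blocks n)
hub∉blocks n = All.tabulate λ t∈blocks hub≡t →
  case ∈-cartesianProductWith⁻ block (allFin n) parts t∈blocks of λ where
    (_ , _ , _ , _ , refl) → case hub≡t of λ ()

module LowerBound (n : ℕ) (D : Subset (order (Middle (Friendship n))))
                  (dominating : IsTotalDominating (Middle (Friendship n)) D)
                  (connected : ComplementConnected (Middle (Friendship n)) D) where
  open RoleEncoding n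

  InD : Role n → Set
  InD r = enc r ∈ D

  InD? : Decidable InD
  InD? r = enc r ∈? D

  dominator : ∀ r → ∃ λ t → InD t × adjRole r t ≡ true
  dominator r with dominating (enc r)
  ... | u , u∈D , r∼u = dec u , subst (_∈ D) (sym (enc-dec u)) u∈D , trans (sym (adj-enc-dec r u)) r∼u

  hub-dominated : ∃₂ λ k s → InD (block k (spoke s))
  hub-dominated with dominator hub
  ... | t , t∈D , hub∼t with hub-neighbour t hub∼t
  ...   | k , s , refl = k , s , t∈D

  leaf-dominated : ∀ k s → InD (block k (spoke s)) ⊎ InD (block k rim)
  leaf-dominated k s with dominator (block k (leaf s))
  ... | t , t∈D , leaf∼t with leaf-neighbour k s t leaf∼t
  ...   | inj₁ refl = inj₁ t∈D
  ...   | inj₂ refl = inj₂ t∈D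

  rim-dominated : ∀ k → ∃ λ p → InD (block k p) × p ≢ rim
  rim-dominated k with dominator (block k rim)
  ... | t , t∈D , rim∼t with rim-neighbour k t rim∼t
  ...   | p , refl , p≢rim = p , t∈D , p≢rim

  reaches-hub : (S : Role n → Set) → (∀ {r t} → S r → ¬ InD r → adjRole r t ≡ true → ¬ InD t → S t) →
                ∀ {r} → S r → ¬ InD r → ¬ InD hub → S hub
  reaches-hub S closed {r} Sr r∉D hub∉D =
    subst S (dec-enc hub) (closed-contains-outside connected closed′ (subst S (sym (dec-enc r)) Sr) r∉D hub∉D)
    where
    closed′ : OutsideClosed {G = Middle (Friendship n)} {D = D} (S ∘ dec)
    closed′ {x} {y} Sx x∉D x∼y y∉D =
      closed Sx (x∉D ∘ subst (_∈ D) (enc-dec x)) (trans (sym (adj-dec x y)) x∼y) (y∉D ∘ subst (_∈ D) (enc-dec y))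

  leaf-forced : ∀ k s → ¬ InD hub → InD (block k (spoke s)) → InD (block k rim) → InD (block k (leaf s))
  leaf-forced k s hub∉D spoke∈D rim∈D = decidable-stable (InD? (block k (leaf s))) λ leaf∉D →
    case reaches-hub (_≡ block k (leaf s)) closed refl leaf∉D hub∉D of λ ()
    where
    closed : ∀ {r t} → r ≡ block k (leaf s) → ¬ InD r → adjRole r t ≡ true → ¬ InD t → t ≡ block k (leaf s)
    closed {t = t} refl _ leaf∼t t∉D with leaf-neighbour k s t leaf∼t
    ... | inj₁ refl = contradiction spoke∈D t∉D
    ... | inj₂ refl = contradiction rim∈D t∉D

  rim-forced : ∀ k → ¬ InD hub → InD (block k (spoke 0F)) → InD (block k (spoke 1F)) → InD (block k rim)
  rim-forced k hub∉D spoke₀∈D spoke₁∈D = decidable-stable (InD? (block k rim)) λ rim∉D →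
    case reaches-hub InBlock closed (rim , refl) rim∉D hub∉D of λ ()
    where
    InBlock : Role n → Set
    InBlock t = ∃ λ p → t ≡ block k p
    closed : ∀ {r t} → InBlock r → ¬ InD r → adjRole r t ≡ true → ¬ InD t → InBlock t
    closed {t = t} (leaf s , refl) _ leaf∼t _ with leaf-neighbour k s t leaf∼t
    ... | inj₁ refl = spoke s , refl
    ... | inj₂ refl = rim , refl
    closed (spoke 0F , refl) spoke∉D _ _ = contradiction spoke₀∈D spoke∉D
    closed (spoke 1F , refl) spoke∉D _ _ = contradiction spoke₁∈D spoke∉D
    closed {t = t} (rim , refl) _ rim∼t _ with rim-neighbour k t rim∼t
    ... | p , refl , _ = p , refl

  blockCount : Fin n → ℕ
  blockCount k = length (filter InD? (map (block k) parts))

  count-sublist : ∀ {k ys} → ys ⊆ map (block k) parts → All InD ys → length ys ≤ blockCount k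
  count-sublist = length-≤-filter InD?

  at-least-two : ∀ k → 2 ≤ blockCount k
  at-least-two k with leaf-dominated k 0F | leaf-dominated k 1F
  ... | inj₁ s₀ | inj₁ s₁ = count-sublist (_ ∷ʳ _ ∷ʳ refl ∷ refl ∷ _ ∷ʳ []) (s₀ ∷ s₁ ∷ [])
  ... | inj₁ s₀ | inj₂ r  = count-sublist (_ ∷ʳ _ ∷ʳ refl ∷ _ ∷ʳ refl ∷ []) (s₀ ∷ r ∷ [])
  ... | inj₂ r  | _ with rim-dominated k
  ...   | leaf 0F  , l , _       = count-sublist (refl ∷ _ ∷ʳ _ ∷ʳ _ ∷ʳ refl ∷ []) (l ∷ r ∷ [])
  ...   | leaf 1F  , l , _       = count-sublist (_ ∷ʳ refl ∷ _ ∷ʳ _ ∷ʳ refl ∷ []) (l ∷ r ∷ [])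
  ...   | spoke 0F , s , _       = count-sublist (_ ∷ʳ _ ∷ʳ refl ∷ _ ∷ʳ refl ∷ []) (s ∷ r ∷ [])
  ...   | spoke 1F , s , _       = count-sublist (_ ∷ʳ _ ∷ʳ _ ∷ʳ refl ∷ refl ∷ []) (s ∷ r ∷ [])
  ...   | rim      , _ , rim≢rim = contradiction refl rim≢rim

  at-least-three : ∀ k s → ¬ InD hub → InD (block k (spoke s)) → 3 ≤ blockCount k
  at-least-three k s hub∉D spoke∈D with InD? (block k rim)
  ... | no rim∉D = contradiction (rim-forced k hub∉D (spoke∈ 0F) (spoke∈ 1F)) rim∉D
    where
    spoke∈ : ∀ s → InD (block k (spoke s))
    spoke∈ s = [ id , (λ rim∈D → contradiction rim∈D rim∉D) ]′ (leaf-dominated k s)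
  ... | yes rim∈D with s | spoke∈D | leaf-forced k s hub∉D spoke∈D rim∈D
  ...   | 0F | s∈ | l∈ = count-sublist (refl ∷ _ ∷ʳ refl ∷ _ ∷ʳ refl ∷ []) (l∈ ∷ s∈ ∷ rim∈D ∷ [])
  ...   | 1F | s∈ | l∈ = count-sublist (_ ∷ʳ refl ∷ _ ∷ʳ refl ∷ refl ∷ []) (l∈ ∷ s∈ ∷ rim∈D ∷ [])

  members-bound : ∀ {rs} → Unique rs → length (filter InD? rs) ≤ ∣ D ∣
  members-bound {rs} unique = subst (_≤ ∣ D ∣) (length-map enc (filter InD? rs))
    (Unique⇒length≤∣∣ (Unique.map⁺ enc-injective (filter⁺ InD? unique)) (All-map⁺ (all-filter InD? rs)))

  blocks-length : length (allFin n) * 2 ≡ 2 * n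
  blocks-length = trans (cong (_* 2) (length-tabulate {n = n} id)) (*-comm n 2)

  lower-bound : suc (2 * n) ≤ ∣ D ∣
  lower-bound with InD? hub
  ... | yes hub∈D = begin
    suc (2 * n)                            ≡⟨ cong suc blocks-length ⟨
    suc (length (allFin n) * 2)
      ≤⟨ s≤s (filter-cartesianProductWith-≥ InD? block parts 2 at-least-two (allFin n)) ⟩
    suc (length (filter InD? (blocks n)))  ≡⟨ cong length (filter-accept InD? hub∈D) ⟨
    length (filter InD? (hub ∷ blocks n))  ≤⟨ members-bound (hub∉blocks n ∷ blocks-unique n) ⟩
    ∣ D ∣                                  ∎
    where open ≤-Reasoning
  ... | no hub∉D with hub-dominated
  ...   | k , s , spoke∈D = begin
    suc (2 * n)                            ≡⟨ cong suc blocks-length ⟨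
    suc (length (allFin n) * 2)
      ≤⟨ filter-cartesianProductWith-> InD? block parts 2 at-least-two (∈-allFin k) (at-least-three k s hub∉D spoke∈D) ⟩
    length (filter InD? (blocks n))        ≤⟨ members-bound (blocks-unique n) ⟩
    ∣ D ∣                                  ∎
    where open ≤-Reasoning

-- The upper bound

module UpperBound (n : ℕ) (k₀ : Fin n) where
  open RoleEncoding n

  data Chosen : Role n → Set where
    chosen-spoke : Chosen (block k₀ (spoke 0F))
    chosen-leaf  : ∀ k → Chosen (block k (leaf 0F))
    chosen-rim   : ∀ k → Chosen (block k rim)

  firstLeaf rimOf : Fin n → Role n
  firstLeaf k = block k (leaf 0F)
  rimOf     k = block k rim

  chosen : List (Role n)
  chosen = block k₀ (spoke 0F) ∷ tabulate firstLeaf ++ tabulate rimOf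

  chosen-length : length chosen ≡ suc (2 * n)
  chosen-length = cong suc (trans (length-++ (tabulate firstLeaf) {tabulate rimOf})
    (cong₂ _+_ (length-tabulate firstLeaf) (trans (length-tabulate rimOf) (sym (+-identityʳ n)))))

  ∈-chosen⁺ : ∀ {r} → Chosen r → r ∈ₗ chosen
  ∈-chosen⁺ chosen-spoke    = here refl
  ∈-chosen⁺ (chosen-leaf k) = there (∈-++⁺ˡ (∈-tabulate⁺ k))
  ∈-chosen⁺ (chosen-rim k)  = there (∈-++⁺ʳ _ (∈-tabulate⁺ k))

  ∈-chosen⁻ : ∀ {r} → r ∈ₗ chosen → Chosen r
  ∈-chosen⁻ (here refl) = chosen-spoke
  ∈-chosen⁻ (there r∈) with ∈-++⁻ (tabulate firstLeaf) r∈
  ... | inj₁ r∈leaves with ∈-tabulate⁻ r∈leaves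
  ...   | k , refl = chosen-leaf k
  ∈-chosen⁻ (there r∈) | inj₂ r∈rims with ∈-tabulate⁻ r∈rims
  ...   | k , refl = chosen-rim k

  D₀ : Subset (order (Middle (Friendship n)))
  D₀ = fromList (map enc chosen)

  ∣D₀∣≤ : ∣ D₀ ∣ ≤ suc (2 * n)
  ∣D₀∣≤ = subst (∣ D₀ ∣ ≤_) (trans (length-map enc chosen) chosen-length) (∣fromList∣≤length (map enc chosen))

  ∈D₀⁺ : ∀ {r} → Chosen r → enc r ∈ D₀
  ∈D₀⁺ = ∈-fromList⁺ ∘ ∈-map⁺ enc ∘ ∈-chosen⁺

  ∉D₀ : ∀ r → ¬ Chosen r → enc r ∉ D₀
  ∉D₀ r ¬chosen r∈D₀ with ∈-map⁻ enc (∈-fromList⁻ (map enc chosen) r∈D₀)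
  ... | t , t∈ , r≡t = ¬chosen (subst Chosen (sym (enc-injective r≡t)) (∈-chosen⁻ t∈))

  edge : ∀ r t → adjRole r t ≡ true → adj (Middle (Friendship n)) (enc r) (enc t) ≡ true
  edge r t = trans (adj-enc r t)

  dominating : IsTotalDominating (Middle (Friendship n)) D₀
  dominating x = subst (λ y → ∃ λ u → u ∈ D₀ × adj (Middle (Friendship n)) y u ≡ true) (enc-dec x) (dominator (dec x))
    where
    dominator : ∀ r → ∃ λ u → u ∈ D₀ × adj (Middle (Friendship n)) (enc r) u ≡ true
    dominator hub =
      enc (block k₀ (spoke 0F)) , ∈D₀⁺ chosen-spoke , edge hub (block k₀ (spoke 0F)) (hub∼spoke k₀ 0F)
    dominator (block k (leaf s)) =
      enc (block k rim) , ∈D₀⁺ (chosen-rim k) , edge (block k (leaf s)) (block k rim) (leaf∼rim k s)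
    dominator (block k (spoke s)) =
      enc (block k rim) , ∈D₀⁺ (chosen-rim k) , edge (block k (spoke s)) (block k rim) (spoke∼rim k s)
    dominator (block k rim) =
      enc (block k (leaf 0F)) , ∈D₀⁺ (chosen-leaf k) , edge (block k rim) (block k (leaf 0F)) (rim∼leaf k 0F)

  hub∉D₀ : enc hub ∉ D₀
  hub∉D₀ = ∉D₀ hub λ ()

  to-hub : ∀ r → ¬ Chosen r → WalkOutside (Middle (Friendship n)) D₀ (enc r) (enc hub)
  to-hub hub                 _  = here hub∉D₀
  to-hub (block k (leaf 0F)) ¬c = contradiction (chosen-leaf k) ¬c
  to-hub (block k (leaf 1F)) ¬c = step (∉D₀ _ ¬c) (edge (block k (leaf 1F)) (block k (spoke 1F)) (leaf∼spoke k 1F))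
                                       (to-hub (block k (spoke 1F)) λ ())
  to-hub (block k (spoke s)) ¬c = step (∉D₀ _ ¬c) (edge (block k (spoke s)) hub (spoke∼hub k s)) (here hub∉D₀)
  to-hub (block k rim)       ¬c = contradiction (chosen-rim k) ¬c

  from-hub : ∀ r → ¬ Chosen r → WalkOutside (Middle (Friendship n)) D₀ (enc hub) (enc r)
  from-hub hub                 _  = here hub∉D₀
  from-hub (block k (leaf 0F)) ¬c = contradiction (chosen-leaf k) ¬c
  from-hub (block k (leaf 1F)) ¬c = walk-++ (from-hub (block k (spoke 1F)) λ ())
    (step (∉D₀ (block k (spoke 1F)) λ ()) (edge (block k (spoke 1F)) (block k (leaf 1F)) (spoke∼leaf k 1F))
          (here (∉D₀ _ ¬c)))
  from-hub (block k (spoke s)) ¬c = step hub∉D₀ (edge hub (block k (spoke s)) (hub∼spoke k s)) (here (∉D₀ _ ¬c))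
  from-hub (block k rim)       ¬c = contradiction (chosen-rim k) ¬c

  connected : ComplementConnected (Middle (Friendship n)) D₀
  connected = connected-through (enc hub)
    (λ u u∉D₀ → subst (λ x → WalkOutside (Middle (Friendship n)) D₀ x (enc hub)) (enc-dec u)
                      (to-hub (dec u) (unchosen u∉D₀)))
    (λ v v∉D₀ → subst (WalkOutside (Middle (Friendship n)) D₀ (enc hub)) (enc-dec v)
                      (from-hub (dec v) (unchosen v∉D₀)))
    where
    unchosen : ∀ {u} → u ∉ D₀ → ¬ Chosen (dec u)
    unchosen {u} u∉D₀ c = u∉D₀ (subst (_∈ D₀) (enc-dec u) (∈D₀⁺ c))

-- The hypothesis 2 ≤ n only excludes n = 0; the argument works for n = 1 as well.
theorem4p9 : (n : ℕ) → 2 ≤ n → γtc≡ (Middle (Friendship n)) (suc (2 * n))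
theorem4p9 zero ()
theorem4p9 n@(suc _) _ =
    (D₀ , (dominating , connected) , ≤-antisym ∣D₀∣≤ (LowerBound.lower-bound n D₀ dominating connected))
  , λ D (dominating′ , connected′) → LowerBound.lower-bound n D dominating′ connected′
  where open UpperBound n Fin.zero
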